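{- Let $\mathcal{C}$ be a category with families. If the canonical morphism $r:\operatorname{cxl}\mathcal{C}\to\mathcal{C}$ admits a section (a morphism $s:\mathcal{C}\to\operatorname{cxl}\mathcal{C}$ with $s$ followed by $r$ equal to the identity of $\mathcal{C}$), then $\mathcal{C}$ is contextual.
   Context: A category with families (CwF) is a category with a chosen terminal object, a presheaf of types and a locally representable dependent presheaf of terms; morphisms of CwFs strictly preserve all this structure. A morphism is a contextual isomorphism if bijective on types and terms; contextual extensions are the morphisms left orthogonal to contextual isomorphisms (an orthogonal factorization system). The contextual core $\operatorname{cxl}\mathcal{C}$ is obtained by factoring the unique morphism $\mathbf{0}\to\mathcal{C}$ from the initial CwF as a contextual extension $\mathbf{0}\to\operatorname{cxl}\mathcal{C}$ followed by a contextual isomorphism $\operatorname{cxl}\mathcal{C}\to\mathcal{C}$. $\mathcal{C}$ is contextual if $\operatorname{cxl}\mathcal{C}\to\mathcal{C}$ is an isomorphism. -}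

module Defs where

open import Level using (0ℓ)
open import Data.Product using (Σ; _×_; _,_; proj₁; proj₂)
open import Data.Product.Properties using (Σ-≡,≡→≡)
open import Relation.Binary.PropositionalEquality
  using (_≡_; refl; sym; trans; cong; subst; subst₂)
open import Function.Definitions using (Bijective)

record CwF : Set₁ where
  infixl 9 _∘_
  infixl 8 _[_]T _[_]t
  infixl 5 _▹_
  infixl 6 _,ₛ_
  field
    Con  : Set
    Sub  : Con → Con → Set
    id   : ∀ {Γ} → Sub Γ Γ
    _∘_  : ∀ {Γ Δ Θ} → Sub Δ Θ → Sub Γ Δ → Sub Γ Θ
    ass  : ∀ {Γ Δ Θ Ξ} (σ : Sub Θ Ξ) (δ : Sub Δ Θ) (ν : Sub Γ Δ) →
           (σ ∘ δ) ∘ ν ≡ σ ∘ (δ ∘ ν)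
    idl  : ∀ {Γ Δ} (σ : Sub Γ Δ) → id ∘ σ ≡ σ
    idr  : ∀ {Γ Δ} (σ : Sub Γ Δ) → σ ∘ id ≡ σ
    ◇    : Con
    ε    : ∀ {Γ} → Sub Γ ◇
    ◇η   : ∀ {Γ} (σ : Sub Γ ◇) → σ ≡ ε
    Ty    : Con → Set
    _[_]T : ∀ {Γ Δ} → Ty Δ → Sub Γ Δ → Ty Γ
    [id]T : ∀ {Γ} (A : Ty Γ) → A [ id ]T ≡ A
    [∘]T  : ∀ {Γ Δ Θ} (A : Ty Θ) (σ : Sub Δ Θ) (δ : Sub Γ Δ) →
            A [ σ ∘ δ ]T ≡ A [ σ ]T [ δ ]T
    Tm    : (Γ : Con) → Ty Γ → Set
    _[_]t : ∀ {Γ Δ} {A : Ty Δ} → Tm Δ A → (σ : Sub Γ Δ) → Tm Γ (A [ σ ]T)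
    [id]t : ∀ {Γ} {A : Ty Γ} (t : Tm Γ A) →
            subst (Tm Γ) ([id]T A) (t [ id ]t) ≡ t
    [∘]t  : ∀ {Γ Δ Θ} {A : Ty Θ} (t : Tm Θ A) (σ : Sub Δ Θ) (δ : Sub Γ Δ) →
            subst (Tm Γ) ([∘]T A σ δ) (t [ σ ∘ δ ]t) ≡ t [ σ ]t [ δ ]t
    _▹_   : (Γ : Con) → Ty Γ → Con
    p     : ∀ {Γ} {A : Ty Γ} → Sub (Γ ▹ A) Γ
    q     : ∀ {Γ} {A : Ty Γ} → Tm (Γ ▹ A) (A [ p ]T)
    _,ₛ_  : ∀ {Γ Δ} {A : Ty Δ} (σ : Sub Γ Δ) → Tm Γ (A [ σ ]T) → Sub Γ (Δ ▹ A)
    ▹β₁   : ∀ {Γ Δ} {A : Ty Δ} (σ : Sub Γ Δ) (t : Tm Γ (A [ σ ]T)) →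
            p ∘ (σ ,ₛ t) ≡ σ
    ▹β₂   : ∀ {Γ Δ} {A : Ty Δ} (σ : Sub Γ Δ) (t : Tm Γ (A [ σ ]T)) →
            subst (Tm Γ) (trans (sym ([∘]T A p (σ ,ₛ t))) (cong (A [_]T) (▹β₁ σ t)))
                  (q [ σ ,ₛ t ]t) ≡ t
    ▹η    : ∀ {Γ Δ} {A : Ty Δ} (σ : Sub Γ (Δ ▹ A)) →
            ((p ∘ σ) ,ₛ subst (Tm Γ) (sym ([∘]T A p σ)) (q [ σ ]t)) ≡ σ

record MorData (C D : CwF) : Set where
  private
    module C = CwF C
    module D = CwF D
  field
    F₀ : C.Con → D.Con
    F₁ : ∀ {Γ Δ} → C.Sub Γ Δ → D.Sub (F₀ Γ) (F₀ Δ)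
    FT : ∀ {Γ} → C.Ty Γ → D.Ty (F₀ Γ)
    Ft : ∀ {Γ} {A : C.Ty Γ} → C.Tm Γ A → D.Tm (F₀ Γ) (FT A)

open MorData public

idData : (C : CwF) → MorData C C
idData C = record { F₀ = λ Γ → Γ ; F₁ = λ σ → σ ; FT = λ A → A ; Ft = λ t → t }

-- composition in diagrammatic-free notation: (G ∘d F) = "F followed by G"
_∘d_ : ∀ {B C D} → MorData C D → MorData B C → MorData B D
G ∘d F = record
  { F₀ = λ Γ → F₀ G (F₀ F Γ)
  ; F₁ = λ σ → F₁ G (F₁ F σ)
  ; FT = λ A → FT G (FT F A)
  ; Ft = λ t → Ft G (Ft F t)
  }

record _≈_ {C D : CwF} (F G : MorData C D) : Set where
  private
    module C = CwF C
    module D = CwF D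
  field
    ob  : ∀ Γ → F₀ F Γ ≡ F₀ G Γ
    sub : ∀ {Γ Δ} (σ : C.Sub Γ Δ) → subst₂ D.Sub (ob Γ) (ob Δ) (F₁ F σ) ≡ F₁ G σ
    ty  : ∀ {Γ} (A : C.Ty Γ) → subst D.Ty (ob Γ) (FT F A) ≡ FT G A
    tm  : ∀ {Γ} {A : C.Ty Γ} (t : C.Tm Γ A) →
          subst (λ (X : Σ D.Con D.Ty) → D.Tm (proj₁ X) (proj₂ X))
                (Σ-≡,≡→≡ (ob Γ , ty A)) (Ft F t) ≡ Ft G t

record Mor (C D : CwF) : Set where
  private
    module C = CwF C
    module D = CwF D
  field
    dat : MorData C D
  private
    F₀' = F₀ dat
    F₁' : ∀ {Γ Δ} → C.Sub Γ Δ → D.Sub (F₀' Γ) (F₀' Δ)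
    F₁' = F₁ dat
    FT' : ∀ {Γ} → C.Ty Γ → D.Ty (F₀' Γ)
    FT' = FT dat
    Ft' : ∀ {Γ} {A : C.Ty Γ} → C.Tm Γ A → D.Tm (F₀' Γ) (FT' A)
    Ft' = Ft dat
  field
    F-id  : ∀ {Γ} → F₁' (C.id {Γ}) ≡ D.id
    F-∘   : ∀ {Γ Δ Θ} (σ : C.Sub Δ Θ) (δ : C.Sub Γ Δ) →
            F₁' (σ C.∘ δ) ≡ F₁' σ D.∘ F₁' δ
    F-◇   : F₀' C.◇ ≡ D.◇
    F-T[] : ∀ {Γ Δ} (A : C.Ty Δ) (σ : C.Sub Γ Δ) →
            FT' (A C.[ σ ]T) ≡ FT' A D.[ F₁' σ ]T
    F-t[] : ∀ {Γ Δ} {A : C.Ty Δ} (t : C.Tm Δ A) (σ : C.Sub Γ Δ) →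
            subst (D.Tm (F₀' Γ)) (F-T[] A σ) (Ft' (t C.[ σ ]t)) ≡ Ft' t D.[ F₁' σ ]t
    F-▹   : ∀ {Γ} (A : C.Ty Γ) → F₀' (Γ C.▹ A) ≡ F₀' Γ D.▹ FT' A
    F-p   : ∀ {Γ} (A : C.Ty Γ) →
            subst (λ Θ → D.Sub Θ (F₀' Γ)) (F-▹ A) (F₁' (C.p {Γ} {A})) ≡ D.p
    F-q   : ∀ {Γ} (A : C.Ty Γ) →
            subst (λ (X : Σ D.Con (λ Θ → D.Sub Θ (F₀' Γ))) → D.Tm (proj₁ X) (FT' A D.[ proj₂ X ]T))
                  (Σ-≡,≡→≡ (F-▹ A , F-p A))
                  (subst (D.Tm (F₀' (Γ C.▹ A))) (F-T[] A C.p) (Ft' (C.q {Γ} {A})))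
              ≡ D.q

open Mor public

IsIso : ∀ {C D} → Mor C D → Set
IsIso {C} {D} F =
  Σ (Mor D C) λ G → ((dat G ∘d dat F) ≈ idData C) × ((dat F ∘d dat G) ≈ idData D)

IsCxlIso : ∀ {C D} → Mor C D → Set
IsCxlIso {C} {D} F =
  (∀ (Γ : CwF.Con C) → Bijective _≡_ _≡_ (FT (dat F) {Γ}))
  × (∀ (Γ : CwF.Con C) (A : CwF.Ty C Γ) → Bijective _≡_ _≡_ (Ft (dat F) {Γ} {A}))

-- left orthogonal to every contextual isomorphism
IsCxlExt : ∀ {A B} → Mor A B → Set₁
IsCxlExt {A} {B} E =
  ∀ (X Y : CwF) (G : Mor X Y) → IsCxlIso G →
  (u : Mor A X) (v : Mor B Y) → (dat G ∘d dat u) ≈ (dat v ∘d dat E) →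
  Σ (Mor B X) λ d →
    ((dat d ∘d dat E) ≈ dat u × (dat G ∘d dat d) ≈ dat v)
    × (∀ (d' : Mor B X) → (dat d' ∘d dat E) ≈ dat u → (dat G ∘d dat d') ≈ dat v →
         dat d' ≈ dat d)

IsInitial : CwF → Set₁
IsInitial I = ∀ (C : CwF) → Σ (Mor I C) λ f → ∀ (g : Mor I C) → dat g ≈ dat f

record CxlCore (C : CwF) : Set₁ where
  field
    𝟎       : CwF
    𝟎-init  : IsInitial 𝟎
    cxl     : CwF
    e       : Mor 𝟎 cxl
    e-ext   : IsCxlExt e
    r       : Mor cxl C
    r-iso   : IsCxlIso r
    factors : (dat r ∘d dat e) ≈ dat (proj₁ (𝟎-init C))

IsContextual : CwF → Set₁
IsContextual C = ∀ (K : CxlCore C) → IsIso (CxlCore.r K)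

-- Both s ∘ r and the identity of cxl C are diagonal fillers of the square
-- formed by e : 0 → cxl C and the contextual isomorphism r (against itself):
-- s ∘ r ∘ e ≈ e because 0 is initial, and r ∘ s ∘ r ≈ r because s is a
-- section of r.  Since e is a contextual extension, fillers are unique, so
-- s ∘ r ≈ id, and s is a two-sided inverse of r.
module Submission where

open import Defs
open import Data.Product using (Σ; _,_; proj₁; proj₂)
open import Data.Product.Properties using (Σ-≡,≡→≡)
open import Relation.Binary.PropositionalEquality
  using (_≡_; refl; sym; trans; cong; subst; subst₂)

idᴹ : (C : CwF) → Mor C C
idᴹ C = record
  { dat = idData C ; F-id = refl ; F-∘ = λ _ _ → refl ; F-◇ = refl
  ; F-T[] = λ _ _ → refl ; F-t[] = λ _ _ → refl ; F-▹ = λ _ → refl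
  ; F-p = λ _ → refl ; F-q = λ _ → refl }

module Composition {B C D : CwF} (G : Mor C D) (F : Mor B C) where
  private
    module B = CwF B
    module C = CwF C
    module D = CwF D
    G₀ = F₀ (dat G)
    G₁ : ∀ {Γ Δ} → C.Sub Γ Δ → D.Sub (G₀ Γ) (G₀ Δ)
    G₁ = F₁ (dat G)
    GT : ∀ {Γ} → C.Ty Γ → D.Ty (G₀ Γ)
    GT = FT (dat G)
    Gt : ∀ {Γ} {A : C.Ty Γ} → C.Tm Γ A → D.Tm (G₀ Γ) (GT A)
    Gt = Ft (dat G)

  subst-Tm-trans : ∀ {X} {a b : C.Ty X} (e : a ≡ b) {u : C.Tm X a} {v : C.Tm X b} →
                   subst (C.Tm X) e u ≡ v →
                   ∀ {c} (e′ : GT b ≡ c) {w} →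
                   subst (D.Tm (G₀ X)) e′ (Gt v) ≡ w →
                   subst (D.Tm (G₀ X)) (trans (cong GT e) e′) (Gt u) ≡ w
  subst-Tm-trans refl refl refl eq = eq

  subst-Sub-trans : ∀ {Θ X Y} {x : C.Sub X Θ} {y : C.Sub Y Θ} (e : X ≡ Y) →
                    subst (λ Ξ → C.Sub Ξ Θ) e x ≡ y →
                    ∀ {Z} (e′ : G₀ Y ≡ Z) {w} →
                    subst (λ Ξ → D.Sub Ξ (G₀ Θ)) e′ (G₁ y) ≡ w →
                    subst (λ Ξ → D.Sub Ξ (G₀ Θ)) (trans (cong G₀ e) e′) (G₁ x) ≡ w
  subst-Sub-trans refl refl e′ eq = eq

  subst-q-trans : ∀ {Θ} (A : C.Ty Θ) {X} {x : C.Sub X Θ} (e : X ≡ Θ C.▹ A)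
                  (ep : subst (λ Ξ → C.Sub Ξ Θ) e x ≡ C.p)
                  {T : C.Ty X} (eT : T ≡ A C.[ x ]T) {t : C.Tm X T} →
                  subst (λ (Y : Σ C.Con (λ Ξ → C.Sub Ξ Θ)) → C.Tm (proj₁ Y) (A C.[ proj₂ Y ]T))
                        (Σ-≡,≡→≡ (e , ep)) (subst (C.Tm X) eT t) ≡ C.q →
                  subst (λ (Y : Σ D.Con (λ Ξ → D.Sub Ξ (G₀ Θ))) → D.Tm (proj₁ Y) (GT A D.[ proj₂ Y ]T))
                        (Σ-≡,≡→≡ (trans (cong G₀ e) (F-▹ G A) ,
                                  subst-Sub-trans e ep (F-▹ G A) (F-p G A)))
                        (subst (D.Tm (G₀ X)) (trans (cong GT eT) (F-T[] G A x)) (Gt t)) ≡ D.q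
  subst-q-trans A refl refl refl refl = F-q G A

  _∘ᴹ_ : Mor B D
  _∘ᴹ_ = record
    { dat   = dat G ∘d dat F
    ; F-id  = trans (cong G₁ (F-id F)) (F-id G)
    ; F-∘   = λ σ δ → trans (cong G₁ (F-∘ F σ δ)) (F-∘ G _ _)
    ; F-◇   = trans (cong G₀ (F-◇ F)) (F-◇ G)
    ; F-T[] = λ A σ → trans (cong GT (F-T[] F A σ)) (F-T[] G _ _)
    ; F-t[] = λ t σ → subst-Tm-trans (F-T[] F _ σ) (F-t[] F t σ)
                                     (F-T[] G _ _) (F-t[] G _ _)
    ; F-▹   = λ A → trans (cong G₀ (F-▹ F A)) (F-▹ G _)
    ; F-p   = λ A → subst-Sub-trans (F-▹ F A) (F-p F A) (F-▹ G _) (F-p G _)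
    ; F-q   = λ A → subst-q-trans (FT (dat F) A) (F-▹ F A) (F-p F A)
                                  (F-T[] F A B.p) (F-q F A)
    }

open Composition using (_∘ᴹ_)

module _ {C D : CwF} where
  private
    module D = CwF D

    TmΣ : Σ D.Con D.Ty → Set
    TmΣ X = D.Tm (proj₁ X) (proj₂ X)

    subst-Ty-sym : ∀ {Γ Δ} (e : Γ ≡ Δ) {a : D.Ty Γ} {b} →
                   subst D.Ty e a ≡ b → subst D.Ty (sym e) b ≡ a
    subst-Ty-sym refl refl = refl

    subst-Tm-sym : ∀ {Γ Δ} (e : Γ ≡ Δ) {a : D.Ty Γ} {b} (eT : subst D.Ty e a ≡ b) {u v} →
                   subst TmΣ (Σ-≡,≡→≡ (e , eT)) u ≡ v →
                   subst TmΣ (Σ-≡,≡→≡ (sym e , subst-Ty-sym e eT)) v ≡ u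
    subst-Tm-sym refl refl refl = refl

    subst₂-Sub-sym : ∀ {Γ Γ′ Δ Δ′} (a : Γ ≡ Γ′) (b : Δ ≡ Δ′) {x y} →
                     subst₂ D.Sub a b x ≡ y → subst₂ D.Sub (sym a) (sym b) y ≡ x
    subst₂-Sub-sym refl refl refl = refl

    subst-Ty-trans : ∀ {X Y Z} (e₁ : X ≡ Y) (e₂ : Y ≡ Z) {a : D.Ty X} {b c} →
                     subst D.Ty e₁ a ≡ b → subst D.Ty e₂ b ≡ c →
                     subst D.Ty (trans e₁ e₂) a ≡ c
    subst-Ty-trans refl refl refl refl = refl

    subst-Tm-trans : ∀ {X Y Z} (e₁ : X ≡ Y) (e₂ : Y ≡ Z) {a : D.Ty X} {b c}
                     (t₁ : subst D.Ty e₁ a ≡ b) (t₂ : subst D.Ty e₂ b ≡ c) {u v w} →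
                     subst TmΣ (Σ-≡,≡→≡ (e₁ , t₁)) u ≡ v →
                     subst TmΣ (Σ-≡,≡→≡ (e₂ , t₂)) v ≡ w →
                     subst TmΣ (Σ-≡,≡→≡ (trans e₁ e₂ , subst-Ty-trans e₁ e₂ t₁ t₂)) u ≡ w
    subst-Tm-trans refl refl refl refl refl refl = refl

    subst₂-Sub-trans : ∀ {Γ Γ′ Γ″ Δ Δ′ Δ″} (a : Γ ≡ Γ′) (a′ : Γ′ ≡ Γ″)
                       (b : Δ ≡ Δ′) (b′ : Δ′ ≡ Δ″) {x y z} →
                       subst₂ D.Sub a b x ≡ y → subst₂ D.Sub a′ b′ y ≡ z →
                       subst₂ D.Sub (trans a a′) (trans b b′) x ≡ z
    subst₂-Sub-trans refl refl refl refl refl refl = refl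

  ≈-refl : {F : MorData C D} → F ≈ F
  ≈-refl = record { ob = λ _ → refl ; sub = λ _ → refl ; ty = λ _ → refl ; tm = λ _ → refl }

  ≈-sym : {F G : MorData C D} → F ≈ G → G ≈ F
  ≈-sym F≈G = record
    { ob  = λ Γ → sym (ob Γ)
    ; sub = λ σ → subst₂-Sub-sym (ob _) (ob _) (sub σ)
    ; ty  = λ A → subst-Ty-sym (ob _) (ty A)
    ; tm  = λ t → subst-Tm-sym (ob _) (ty _) (tm t)
    }
    where open _≈_ F≈G

  ≈-trans : {F G H : MorData C D} → F ≈ G → G ≈ H → F ≈ H
  ≈-trans F≈G G≈H = record
    { ob  = λ Γ → trans (FG.ob Γ) (GH.ob Γ)
    ; sub = λ σ → subst₂-Sub-trans (FG.ob _) (GH.ob _) (FG.ob _) (GH.ob _) (FG.sub σ) (GH.sub σ)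
    ; ty  = λ A → subst-Ty-trans (FG.ob _) (GH.ob _) (FG.ty A) (GH.ty A)
    ; tm  = λ t → subst-Tm-trans (FG.ob _) (GH.ob _) (FG.ty _) (GH.ty _) (FG.tm t) (GH.tm t)
    }
    where
      module FG = _≈_ F≈G
      module GH = _≈_ G≈H

∘d-congˡ : ∀ {B C D} {F G : MorData C D} (H : MorData B C) → F ≈ G → (F ∘d H) ≈ (G ∘d H)
∘d-congˡ H F≈G = record
  { ob = λ Γ → ob (F₀ H Γ) ; sub = λ σ → sub (F₁ H σ) ; ty = λ A → ty (FT H A) ; tm = λ t → tm (Ft H t) }
  where open _≈_ F≈G

initial-≈ : ∀ {I C} → IsInitial I → (f g : Mor I C) → dat f ≈ dat g
initial-≈ {C = C} init f g = ≈-trans (proj₂ (init C) f) (≈-sym (proj₂ (init C) g))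

cxlExt-filler-unique : ∀ {A B X Y} {E : Mor A B} → IsCxlExt E →
                       (G : Mor X Y) → IsCxlIso G → (u : Mor A X) (v : Mor B Y) →
                       (dat G ∘d dat u) ≈ (dat v ∘d dat E) →
                       (d d′ : Mor B X) →
                       (dat d ∘d dat E) ≈ dat u → (dat G ∘d dat d) ≈ dat v →
                       (dat d′ ∘d dat E) ≈ dat u → (dat G ∘d dat d′) ≈ dat v →
                       dat d ≈ dat d′
cxlExt-filler-unique {X = X} {Y} {E} ext G G-iso u v square d d′ dE≈u Gd≈v d′E≈u Gd′≈v
  with ext X Y G G-iso u v square
... | _ , _ , unique = ≈-trans (unique d dE≈u Gd≈v) (≈-sym (unique d′ d′E≈u Gd′≈v))

cxlExt-endo-≈id : ∀ {A B Y} {E : Mor A B} → IsCxlExt E →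
                  (G : Mor B Y) → IsCxlIso G → (f : Mor B B) →
                  (dat f ∘d dat E) ≈ dat E → (dat G ∘d dat f) ≈ dat G →
                  dat f ≈ idData B
cxlExt-endo-≈id {B = B} {E = E} ext G G-iso f fE≈E Gf≈G =
  cxlExt-filler-unique {E = E} ext G G-iso E G ≈-refl f (idᴹ B) fE≈E Gf≈G ≈-refl ≈-refl

proposition2p8 : (C : CwF) (K : CxlCore C) →
    (s : Mor C (CxlCore.cxl K)) →
    (dat (CxlCore.r K) ∘d dat s) ≈ idData C →
    IsIso (CxlCore.r K)
proposition2p8 C K s rs≈id = s , sr≈id , rs≈id
  where
    open CxlCore K

    sre≈e : ((dat s ∘d dat r) ∘d dat e) ≈ dat e
    sre≈e = initial-≈ 𝟎-init ((s ∘ᴹ r) ∘ᴹ e) e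

    rsr≈r : (dat r ∘d (dat s ∘d dat r)) ≈ dat r
    rsr≈r = ∘d-congˡ {F = dat r ∘d dat s} {G = idData C} (dat r) rs≈id

    sr≈id : (dat s ∘d dat r) ≈ idData cxl
    sr≈id = cxlExt-endo-≈id {E = e} e-ext r r-iso (s ∘ᴹ r) sre≈e rsr≈r
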